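{- Let $\mathcal{N}$ be a tree-child network on $X$, let $\mathcal{C}$ and $\mathcal{C}'$ be tight caterpillar ladders of $\mathcal{N}$ (with maps $\phi$ and $\phi'$), and let $u$ be a vertex of $\mathcal{N}$. If $u$ is the image of a reticulation or of a spine vertex of $\mathcal{C}$ under $\phi$, and also the image of a reticulation or spine vertex of $\mathcal{C}'$ under $\phi'$, then the reticulation and spine vertices of $\mathcal{C}$ and $\mathcal{C}'$ coincide in $\mathcal{N}$; that is, $\mathcal{C}$ and $\mathcal{C}'$ have the same number $k$ of reticulations and, for all $i\in\{1,\dots,k\}$, $\phi(v_i)=\phi'(v_i')$, $\phi(p_i)=\phi'(p_i')$ and $\phi(q_i)=\phi'(q_i')$.
   Context: A (rooted binary) phylogenetic network on a finite nonempty set $X$ is a rooted acyclic directed graph with no parallel arcs such that the root has in-degree 0 and out-degree 2; the leaves (out-degree 0) have in-degree 1 and are exactly the elements of $X$; every other vertex is a tree vertex (in-degree 1, out-degree 2) or a reticulation (in-degree 2, out-degree 1). A tree path is a directed path $v_1,\dots,v_n$ ($n\ge1$) with each of $v_2,\dots,v_n$ a tree vertex or a leaf. The network is tree-child if every non-leaf vertex has a child that is a tree vertex or a leaf. Caterpillar ladder: for $k\ge1$ and distinct labels $\ell_0,\dots,\ell_k$, $\langle\ell_0,\dots,\ell_k\rangle$ has vertices $\ell_0,\dots,\ell_k$ and $v_j,p_j,q_j$ ($1\le j\le k$); arcs: if $k=1$, $(q_1,p_1)$ and $(p_1,\ell_0)$; if $k\ge2$, the arcs of the directed path $q_k,q_{k-1},p_k,q_{k-2},p_{k-1},\dots,q_2,p_3,q_1,p_2,p_1,\ell_0$;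 and for each $j$, $(p_j,v_j),(q_j,v_j),(v_j,\ell_j)$. The spine is the path $q_k,q_{k-1},p_k,\dots,q_1,p_2,p_1$ (the arc $(q_1,p_1)$ if $k=1$); its vertices are the spine vertices and $v_1,\dots,v_k$ are the reticulations of the ladder. It is a tight caterpillar ladder of $\mathcal{N}$ if $\{\ell_0,\dots,\ell_k\}\subseteq X$ and there is an injective map $\phi$ from its vertices to those of $\mathcal{N}$ with $\phi(\ell_j)=\ell_j$ such that (P1) there are tree paths in $\mathcal{N}$ from $\phi(p_1)$ to $\ell_0$ and from $\phi(v_j)$ to $\ell_j$ for each $j\ge1$; (P2) $(\phi(p_j),\phi(v_j))$ and $(\phi(q_j),\phi(v_j))$ are arcs of $\mathcal{N}$; (P3) for each spine arc $(u,w)$, $(\phi(u),\phi(w))$ is an arc of $\mathcal{N}$. For $\mathcal{C}'$ the corresponding vertices are denoted $v_j',p_j',q_j'$. -}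

module Defs where

open import Data.Nat using (ℕ; zero; suc; _+_)
open import Data.Fin using (Fin; toℕ) renaming (zero to fz; suc to fs)
open import Data.List using (List; map; allFin)
open import Data.Nat.ListAction using (sum)
open import Data.Bool using (Bool; true; false; if_then_else_)
open import Data.Product using (Σ; _×_; ∃)
open import Data.Sum using (_⊎_)
open import Relation.Binary.PropositionalEquality using (_≡_; _≢_)
open import Relation.Nullary using (¬_)
open import Function.Definitions using (Injective)

-- Directed graphs on the vertex set Fin n, given by a Boolean arc
-- relation (so there are no parallel arcs by construction).

countTrue : List Bool → ℕ
countTrue bs = sum (map (λ b → if b then 1 else 0) bs)

module _ {n : ℕ} (arc : Fin n → Fin n → Bool) where

  outdeg : Fin n → ℕ
  outdeg v = countTrue (map (λ w → arc v w) (allFin n))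

  indeg : Fin n → ℕ
  indeg v = countTrue (map (λ u → arc u v) (allFin n))

  data Path⁺ : Fin n → Fin n → Set where
    one  : ∀ {u v} → arc u v ≡ true → Path⁺ u v
    cons : ∀ {u w v} → arc u w ≡ true → Path⁺ w v → Path⁺ u v

  Acyclic : Set
  Acyclic = ∀ v → ¬ Path⁺ v v

  IsRoot IsLeaf IsTreeVertex IsReticulation : Fin n → Set
  IsRoot v         = indeg v ≡ 0 × outdeg v ≡ 2
  IsLeaf v         = indeg v ≡ 1 × outdeg v ≡ 0
  IsTreeVertex v   = indeg v ≡ 1 × outdeg v ≡ 2
  IsReticulation v = indeg v ≡ 2 × outdeg v ≡ 1

-- Rooted binary phylogenetic network.  The leaf set X is the set of
-- leaves (out-degree 0 vertices) of the network.

record Network (n : ℕ) : Set where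
  field
    arc     : Fin n → Fin n → Bool
    root    : Fin n
    rootOK  : IsRoot arc root
    acyclic : Acyclic arc
    vertexTypes : ∀ v → v ≡ root ⊎ IsLeaf arc v ⊎ IsTreeVertex arc v ⊎ IsReticulation arc v

module _ {n : ℕ} (N : Network n) where
  open Network N

  TreeOrLeaf : Fin n → Set
  TreeOrLeaf v = IsTreeVertex arc v ⊎ IsLeaf arc v

  data TreePath : Fin n → Fin n → Set where
    here : ∀ v → TreePath v v
    step : ∀ {u w v} → arc u w ≡ true → TreeOrLeaf w → TreePath w v → TreePath u v

  TreeChild : Set
  TreeChild = ∀ v → ¬ IsLeaf arc v →
              Σ (Fin n) λ w → arc v w ≡ true × TreeOrLeaf w

-- Caterpillar ladder ⟨ℓ₀,…,ℓ_k⟩ with k ≥ 1.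
-- Index convention: i : Fin k stands for the index j = toℕ i + 1, so
--   ret i = v_j, pv i = p_j, qv i = q_j  (1 ≤ j ≤ k),
-- and lab j = ℓ_j for j : Fin (suc k) (0 ≤ j ≤ k).

data LV (k : ℕ) : Set where
  lab : Fin (suc k) → LV k
  ret : Fin k → LV k
  pv  : Fin k → LV k
  qv  : Fin k → LV k

-- arcs of the spine
--   k = 1 : (q₁,p₁)
--   k ≥ 2 : q_k,q_{k-1},p_k,q_{k-2},p_{k-1},…,q₂,p₃,q₁,p₂,p₁ i.e. the arcs
--     (q_k,q_{k-1}), (q_j,p_{j+1}) for 1 ≤ j ≤ k-1,
--     (p_j,q_{j-2}) for 3 ≤ j ≤ k, and (p₂,p₁).
data SpineArc (k : ℕ) : LV k → LV k → Set where
  single : ∀ (i : Fin k) → k ≡ 1 → SpineArc k (qv i) (pv i)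
  top    : ∀ (i j : Fin k) → suc (toℕ i) ≡ k → toℕ i ≡ suc (toℕ j) → SpineArc k (qv i) (qv j)
  qp     : ∀ (i j : Fin k) → toℕ j ≡ suc (toℕ i) → SpineArc k (qv i) (pv j)
  pq     : ∀ (i j : Fin k) → toℕ i ≡ 2 + toℕ j → SpineArc k (pv i) (qv j)
  pp     : ∀ (i j : Fin k) → toℕ i ≡ 1 → toℕ j ≡ 0 → SpineArc k (pv i) (pv j)

data RetOrSpine {k : ℕ} : LV k → Set where
  isRet : ∀ i → RetOrSpine (ret i)
  isP   : ∀ i → RetOrSpine (pv i)
  isQ   : ∀ i → RetOrSpine (qv i)

-- A tight caterpillar ladder of N, with k = suc k₀ ≥ 1 reticulations.
-- The labels are ℓ_j = φ (lab j); they are leaves of N (so lie in X),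
-- and are distinct since φ is injective.
record TightLadder {n : ℕ} (N : Network n) : Set where
  open Network N
  field
    k₀       : ℕ
    φ        : LV (suc k₀) → Fin n
    φ-inj    : Injective _≡_ _≡_ φ
    labLeaf  : ∀ j → IsLeaf arc (φ (lab j))
    P1-p₁    : TreePath N (φ (pv fz)) (φ (lab fz))
    P1-v     : ∀ i → TreePath N (φ (ret i)) (φ (lab (fs i)))
    P2-p     : ∀ i → arc (φ (pv i)) (φ (ret i)) ≡ true
    P2-q     : ∀ i → arc (φ (qv i)) (φ (ret i)) ≡ true
    P3       : ∀ x y → SpineArc (suc k₀) x y → arc (φ x) (φ y) ≡ true

  k : ℕ
  k = suc k₀

-- Every spine vertex s of a tight ladder has exactly two children: the reticulation v_j
-- and a non-reticulation (the next spine vertex, or for p₁ the first vertex of the tree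
-- path to ℓ₀).  In a binary network s therefore determines both children, and a
-- reticulation determines its two parents.  So as soon as the two ladders share one vertex
-- they share the whole rung (v_j, p_j, q_j) at that position; p and q cannot be swapped,
-- since q_j reaches p_j along the spine and the network is acyclic.  Following the spine
-- down, the shared rung is carried to rung 1 of both ladders (the shape of the spine forces
-- the positions to agree), and following it back up, both ladders have the same rungs all
-- the way to the top, hence the same length.

module Submission where

open import Defs
open import Data.Nat using (ℕ; zero; suc; _+_; _≤_; _<_; z≤n; s≤s; _<?_)
open import Data.Nat.Properties
  using (≤-refl; ≤-reflexive; ≤-trans; ≤-antisym; ≮⇒≥; <-trans; n<1+n; n≮n; +-suc; 0≢1+n; 1+n≢n)
open import Data.Fin using (Fin; toℕ; fromℕ<) renaming (zero to fz; suc to fs)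
open import Data.Fin.Properties using (_≟_; toℕ<n; toℕ-fromℕ<; toℕ-injective)
open import Data.List using ([]; _∷_; length; map; allFin)
open import Data.List.Properties using (map-tabulate)
open import Data.List.Relation.Unary.All using (All; []; _∷_)
open import Data.List.Relation.Unary.AllPairs using (AllPairs; []; _∷_)
open import Data.Bool using (Bool; true; false; if_then_else_)
open import Data.Product using (Σ; _×_; _,_; proj₁; proj₂)
open import Data.Sum using (_⊎_; inj₁; inj₂)
open import Data.Empty using (⊥; ⊥-elim)
open import Function using (_∘_)
open import Relation.Nullary using (¬_; yes; no; does)
open import Relation.Binary.PropositionalEquality

count : ∀ {n} → (Fin n → Bool) → ℕ
count {n} f = countTrue (map f (allFin n))

count-suc : ∀ {n} (f : Fin (suc n) → Bool) →
            count f ≡ (if f fz then 1 else 0) + count (f ∘ fs)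
count-suc {n} f = cong (λ bs → (if f fz then 1 else 0) + countTrue bs)
  (trans (map-tabulate fs f) (sym (map-tabulate (λ i → i) (f ∘ fs))))

remove : ∀ {n} → Fin n → (Fin n → Bool) → Fin n → Bool
remove a f x = if does (x ≟ a) then false else f x

remove-true : ∀ {n} {f : Fin n → Bool} {a x} → a ≢ x → f x ≡ true → remove a f x ≡ true
remove-true {a = a} {x} a≢x fx with x ≟ a
... | yes x≡a = ⊥-elim (a≢x (sym x≡a))
... | no _    = fx

count-remove : ∀ {n} (f : Fin n → Bool) a → f a ≡ true → count f ≡ suc (count (remove a f))
count-remove f fz fa = begin
  count f                                  ≡⟨ count-suc f ⟩
  (if f fz then 1 else 0) + count (f ∘ fs) ≡⟨ cong (λ b → (if b then 1 else 0) + count (f ∘ fs)) fa ⟩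
  suc (count (f ∘ fs))                     ≡⟨ cong suc (sym (count-suc (remove fz f))) ⟩
  suc (count (remove fz f))                ∎
  where open ≡-Reasoning
count-remove f (fs a) fa = begin
  count f                                        ≡⟨ count-suc f ⟩
  b + count (f ∘ fs)                             ≡⟨ cong (b +_) (count-remove (f ∘ fs) a fa) ⟩
  b + suc (count (remove a (f ∘ fs)))            ≡⟨ +-suc b _ ⟩
  suc (b + count (remove a (f ∘ fs)))            ≡⟨ cong suc (sym (count-suc (remove (fs a) f))) ⟩
  suc (count (remove (fs a) f))                  ∎
  where open ≡-Reasoning
        b = if f fz then 1 else 0

distinct-≤-count : ∀ {n} (f : Fin n → Bool) {xs} → AllPairs _≢_ xs →
                   All (λ x → f x ≡ true) xs → length xs ≤ count f
distinct-≤-count f [] [] = z≤n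
distinct-≤-count f {x ∷ xs} (x≢xs ∷ distinct) (fx ∷ fxs)
  rewrite count-remove f x fx =
    s≤s (distinct-≤-count (remove x f) distinct (removed-stay-true x≢xs fxs))
  where
    removed-stay-true : ∀ {ys} → All (x ≢_) ys → All (λ y → f y ≡ true) ys →
                        All (λ y → remove x f y ≡ true) ys
    removed-stay-true []         []          = []
    removed-stay-true (ne ∷ nes) (fy ∷ fys) = remove-true {f = f} ne fy ∷ removed-stay-true nes fys

two-≤-count : ∀ {n} (f : Fin n → Bool) {a b} → f a ≡ true → f b ≡ true → a ≢ b → 2 ≤ count f
two-≤-count f fa fb a≢b = distinct-≤-count f ((a≢b ∷ []) ∷ [] ∷ []) (fa ∷ fb ∷ [])

count≤2⇒one-of-two : ∀ {n} (f : Fin n → Bool) → count f ≤ 2 → ∀ {a b c} →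
                     f a ≡ true → f b ≡ true → f c ≡ true → a ≢ b → c ≡ a ⊎ c ≡ b
count≤2⇒one-of-two f count≤2 {a} {b} {c} fa fb fc a≢b with c ≟ a | c ≟ b
... | yes c≡a | _       = inj₁ c≡a
... | no _    | yes c≡b = inj₂ c≡b
... | no c≢a  | no c≢b  = ⊥-elim (n≮n 2 (≤-trans three≤count count≤2))
  where
    three≤count : 3 ≤ count f
    three≤count = distinct-≤-count f
      ((a≢b ∷ (c≢a ∘ sym) ∷ []) ∷ ((c≢b ∘ sym) ∷ []) ∷ [] ∷ []) (fa ∷ fb ∷ fc ∷ [])

module NetworkProperties {n : ℕ} (N : Network n) where
  open Network N

  Reticulation : Fin n → Set
  Reticulation = IsReticulation arc

  outdeg≤2 : ∀ v → outdeg arc v ≤ 2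
  outdeg≤2 v with vertexTypes v
  ... | inj₁ refl                     = ≤-reflexive (proj₂ rootOK)
  ... | inj₂ (inj₁ (_ , out≡0))        rewrite out≡0 = z≤n
  ... | inj₂ (inj₂ (inj₁ (_ , out≡2))) = ≤-reflexive out≡2
  ... | inj₂ (inj₂ (inj₂ (_ , out≡1))) rewrite out≡1 = s≤s z≤n

  indeg≤2 : ∀ v → indeg arc v ≤ 2
  indeg≤2 v with vertexTypes v
  ... | inj₁ refl rewrite proj₁ rootOK             = z≤n
  ... | inj₂ (inj₁ (in≡1 , _))        rewrite in≡1 = s≤s z≤n
  ... | inj₂ (inj₂ (inj₁ (in≡1 , _))) rewrite in≡1 = s≤s z≤n
  ... | inj₂ (inj₂ (inj₂ (in≡2 , _))) = ≤-reflexive in≡2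

  child-one-of-two : ∀ {s a b c} → arc s a ≡ true → arc s b ≡ true → a ≢ b →
                     arc s c ≡ true → c ≡ a ⊎ c ≡ b
  child-one-of-two {s} sa sb a≢b sc = count≤2⇒one-of-two (arc s) (outdeg≤2 s) sa sb sc a≢b

  parent-one-of-two : ∀ {r a b c} → arc a r ≡ true → arc b r ≡ true → a ≢ b →
                      arc c r ≡ true → c ≡ a ⊎ c ≡ b
  parent-one-of-two {r} ar br a≢b cr =
    count≤2⇒one-of-two (λ x → arc x r) (indeg≤2 r) ar br cr a≢b

  two-parents⇒reticulation : ∀ {r a b} → arc a r ≡ true → arc b r ≡ true → a ≢ b →
                             Reticulation r
  two-parents⇒reticulation {r} ar br a≢b
    with vertexTypes r | ≤-antisym (indeg≤2 r) (two-≤-count (λ x → arc x r) ar br a≢b)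
  ... | inj₁ refl                     | in≡2 = ⊥-elim (0≢1+n (trans (sym (proj₁ rootOK)) in≡2))
  ... | inj₂ (inj₁ (in≡1 , _))        | in≡2 = ⊥-elim (1+n≢n (trans (sym in≡2) in≡1))
  ... | inj₂ (inj₂ (inj₁ (in≡1 , _))) | in≡2 = ⊥-elim (1+n≢n (trans (sym in≡2) in≡1))
  ... | inj₂ (inj₂ (inj₂ r-ret))      | _    = r-ret

  two-children⇒¬reticulation : ∀ {s a b} → arc s a ≡ true → arc s b ≡ true → a ≢ b →
                               ¬ Reticulation s
  two-children⇒¬reticulation {s} sa sb a≢b (_ , out≡1) =
    n≮n 1 (subst (2 ≤_) out≡1 (two-≤-count (arc s) sa sb a≢b))

  treeOrLeaf⇒¬reticulation : ∀ {v} → TreeOrLeaf N v → ¬ Reticulation v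
  treeOrLeaf⇒¬reticulation (inj₁ (in≡1 , _)) (in≡2 , _) = 1+n≢n (trans (sym in≡2) in≡1)
  treeOrLeaf⇒¬reticulation (inj₂ (in≡1 , _)) (in≡2 , _) = 1+n≢n (trans (sym in≡2) in≡1)

  reticulation≢ : ∀ {r v} → Reticulation r → ¬ Reticulation v → r ≢ v
  reticulation≢ r-ret ¬v-ret refl = ¬v-ret r-ret

  HasNonReticulateChild : Fin n → Set
  HasNonReticulateChild s = Σ (Fin n) λ c → arc s c ≡ true × ¬ Reticulation c

  reticulate-child-unique : ∀ {s r r'} → HasNonReticulateChild s →
                            arc s r ≡ true → Reticulation r →
                            arc s r' ≡ true → Reticulation r' → r ≡ r'
  reticulate-child-unique (c , sc , ¬c-ret) sr r-ret sr' r'-ret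
    with child-one-of-two sr sc (reticulation≢ r-ret ¬c-ret) sr'
  ... | inj₁ r'≡r = sym r'≡r
  ... | inj₂ r'≡c = ⊥-elim (reticulation≢ r'-ret ¬c-ret r'≡c)

  nonreticulate-child-unique : ∀ {s r y y'} → arc s r ≡ true → Reticulation r →
                               arc s y ≡ true → ¬ Reticulation y →
                               arc s y' ≡ true → ¬ Reticulation y' → y ≡ y'
  nonreticulate-child-unique sr r-ret sy ¬y-ret sy' ¬y'-ret
    with child-one-of-two sr sy (reticulation≢ r-ret ¬y-ret) sy'
  ... | inj₁ y'≡r = ⊥-elim (reticulation≢ r-ret ¬y'-ret (sym y'≡r))
  ... | inj₂ y'≡y = sym y'≡y

  tree-path-first-step : ∀ {a b} → TreePath N a b → a ≢ b →
                         Σ (Fin n) λ w → arc a w ≡ true × TreeOrLeaf N w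
  tree-path-first-step (here _)          a≢a = ⊥-elim (a≢a refl)
  tree-path-first-step (step a→w w-tree _) _ = _ , a→w , w-tree

  _++⁺_ : ∀ {a b c} → Path⁺ arc a b → Path⁺ arc b c → Path⁺ arc a c
  one ab     ++⁺ q = cons ab q
  cons ab p  ++⁺ q = cons ab (p ++⁺ q)

  module Ladder (C : TightLadder N) where
    open TightLadder C

    -- position m is the index j = m + 1 of the paper; out-of-range positions are sent to
    -- fz, so every lemma below carries the bound m < k
    idx : ℕ → Fin k
    idx m with m <? k
    ... | yes m<k = fromℕ< m<k
    ... | no _    = fz

    toℕ-idx : ∀ {m} → m < k → toℕ (idx m) ≡ m
    toℕ-idx {m} m<k with m <? k
    ... | yes m<k' = toℕ-fromℕ< m<k'
    ... | no m≮k   = ⊥-elim (m≮k m<k)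

    idx-toℕ : ∀ i → idx (toℕ i) ≡ i
    idx-toℕ i = toℕ-injective (toℕ-idx (toℕ<n i))

    P Q V : ℕ → Fin n
    P m = φ (pv (idx m))
    Q m = φ (qv (idx m))
    V m = φ (ret (idx m))

    pv≡P : ∀ i → φ (pv i) ≡ P (toℕ i)
    pv≡P i = cong (φ ∘ pv) (sym (idx-toℕ i))

    qv≡Q : ∀ i → φ (qv i) ≡ Q (toℕ i)
    qv≡Q i = cong (φ ∘ qv) (sym (idx-toℕ i))

    ret≡V : ∀ i → φ (ret i) ≡ V (toℕ i)
    ret≡V i = cong (φ ∘ ret) (sym (idx-toℕ i))

    P-injective : ∀ {i j} → i < k → j < k → P i ≡ P j → i ≡ j
    P-injective i<k j<k Pi≡Pj =
      trans (sym (toℕ-idx i<k)) (trans (cong toℕ (pv-injective (φ-inj Pi≡Pj))) (toℕ-idx j<k))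
      where pv-injective : ∀ {a b} → pv {k} a ≡ pv b → a ≡ b
            pv-injective refl = refl

    P≢Q : ∀ i j → P i ≢ Q j
    P≢Q i j e with φ-inj e
    ... | ()

    P≢V : ∀ i j → P i ≢ V j
    P≢V i j e with φ-inj e
    ... | ()

    Q≢V : ∀ i j → Q i ≢ V j
    Q≢V i j e with φ-inj e
    ... | ()

    P→V : ∀ i → arc (P i) (V i) ≡ true
    P→V i = P2-p (idx i)

    Q→V : ∀ i → arc (Q i) (V i) ≡ true
    Q→V i = P2-q (idx i)

    V-reticulation : ∀ i → Reticulation (V i)
    V-reticulation i = two-parents⇒reticulation (P→V i) (Q→V i) (P≢Q i i)

    pred< : ∀ {i} → suc i < k → i < k
    pred< = <-trans (n<1+n _)

    Q→P : ∀ {i} → suc i < k → arc (Q i) (P (suc i)) ≡ true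
    Q→P 1+i<k = P3 _ _ (qp _ _ (trans (toℕ-idx 1+i<k) (cong suc (sym (toℕ-idx (pred< 1+i<k))))))

    P→Q : ∀ {i} → 2 + i < k → arc (P (2 + i)) (Q i) ≡ true
    P→Q 2+i<k =
      P3 _ _ (pq _ _ (trans (toℕ-idx 2+i<k) (cong (2 +_) (sym (toℕ-idx (pred< (pred< 2+i<k)))))))

    P₁→P₀ : 1 < k → arc (P 1) (P 0) ≡ true
    P₁→P₀ 1<k = P3 _ _ (pp _ _ (toℕ-idx 1<k) (toℕ-idx (pred< 1<k)))

    Q-top→Q : ∀ {m} → k ≡ 2 + m → arc (Q (suc m)) (Q m) ≡ true
    Q-top→Q {m} k≡2+m = P3 _ _ (top _ _ (trans (cong suc (toℕ-idx 1+m<k)) (sym k≡2+m))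
                                         (trans (toℕ-idx 1+m<k) (cong suc (sym (toℕ-idx (pred< 1+m<k))))))
      where 1+m<k : suc m < k
            1+m<k = subst (suc m <_) (sym k≡2+m) (n<1+n _)

    Q₀→P₀ : k ≡ 1 → arc (Q 0) (P 0) ≡ true
    Q₀→P₀ k≡1 = P3 _ _ (single _ k≡1)

    data QSpineArc : ℕ → Set where
      inner  : ∀ {i} → suc i < k → QSpineArc i
      single : k ≡ 1 → QSpineArc 0
      top    : ∀ {m} → k ≡ 2 + m → QSpineArc (suc m)

    qSpineArc : ∀ {i} → i < k → QSpineArc i
    qSpineArc {i} i<k with suc i <? k
    ... | yes 1+i<k = inner 1+i<k
    qSpineArc {zero}  i<k | no 1+i≮k = single (≤-antisym (≮⇒≥ 1+i≮k) i<k)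
    qSpineArc {suc m} i<k | no 1+i≮k = top (≤-antisym (≮⇒≥ 1+i≮k) i<k)

    P₀-tree-child : Σ (Fin n) λ w → arc (P 0) w ≡ true × TreeOrLeaf N w
    P₀-tree-child = subst (λ p → Σ (Fin n) λ w → arc p w ≡ true × TreeOrLeaf N w) (pv≡P fz)
      (tree-path-first-step P1-p₁ (λ e → pv≢lab (φ-inj e)))
      where pv≢lab : pv fz ≢ lab fz
            pv≢lab ()

    P-¬reticulation : ∀ {i} → i < k → ¬ Reticulation (P i)
    P-¬reticulation {zero} _ with P₀-tree-child
    ... | w , P₀→w , w-tree = two-children⇒¬reticulation (P→V 0) P₀→w
      (reticulation≢ (V-reticulation 0) (treeOrLeaf⇒¬reticulation w-tree))
    P-¬reticulation {suc zero}    1<k   = two-children⇒¬reticulation (P₁→P₀ 1<k) (P→V 1) (P≢V 0 1)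
    P-¬reticulation {suc (suc m)} 2+m<k =
      two-children⇒¬reticulation (P→Q 2+m<k) (P→V (2 + m)) (Q≢V m (2 + m))

    Q-¬reticulation : ∀ {i} → i < k → ¬ Reticulation (Q i)
    Q-¬reticulation {i} i<k with qSpineArc i<k
    ... | inner 1+i<k = two-children⇒¬reticulation (Q→P 1+i<k) (Q→V i) (P≢V (suc i) i)
    ... | single k≡1  = two-children⇒¬reticulation (Q₀→P₀ k≡1) (Q→V 0) (P≢V 0 0)
    ... | top {m} k≡2+m = two-children⇒¬reticulation (Q-top→Q k≡2+m) (Q→V i) (Q≢V m i)

    P-nonreticulate-child : ∀ {i} → i < k → HasNonReticulateChild (P i)
    P-nonreticulate-child {zero} _ with P₀-tree-child
    ... | w , P₀→w , w-tree = w , P₀→w , treeOrLeaf⇒¬reticulation w-tree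
    P-nonreticulate-child {suc zero}    1<k   = P 0 , P₁→P₀ 1<k , P-¬reticulation (pred< 1<k)
    P-nonreticulate-child {suc (suc m)} 2+m<k = Q m , P→Q 2+m<k , Q-¬reticulation (pred< (pred< 2+m<k))

    Q-nonreticulate-child : ∀ {i} → i < k → HasNonReticulateChild (Q i)
    Q-nonreticulate-child {i} i<k with qSpineArc i<k
    ... | inner 1+i<k = P (suc i) , Q→P 1+i<k , P-¬reticulation 1+i<k
    ... | single k≡1  = P 0 , Q₀→P₀ k≡1 , P-¬reticulation i<k
    ... | top {m} k≡2+m = Q m , Q-top→Q k≡2+m , Q-¬reticulation (pred< i<k)

    Q⇝P : ∀ {i} → i < k → Path⁺ arc (Q i) (P i)
    Q⇝P {i} i<k with qSpineArc i<k
    Q⇝P {zero}  _ | inner 1<k   = cons (Q→P 1<k) (one (P₁→P₀ 1<k))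
    Q⇝P {suc m} _ | inner 2+m<k = cons (Q→P 2+m<k) (cons (P→Q 2+m<k) (one (Q→P (pred< 2+m<k))))
    Q⇝P {zero}  _ | single k≡1  = one (Q₀→P₀ k≡1)
    Q⇝P {suc m} i<k | top k≡2+m = cons (Q-top→Q k≡2+m) (one (Q→P i<k))

  module Pair (C C' : TightLadder N) where
    private
      module A = Ladder C
      module B = Ladder C'
      open A using (inner; single; top)
      open B using (inner; single; top)

      k k' : ℕ
      k  = TightLadder.k C
      k' = TightLadder.k C'

    record Coincide (j j' : ℕ) : Set where
      constructor coincide
      field
        bound  : j < k
        bound' : j' < k'
        V-eq   : A.V j ≡ B.V j'
        P-eq   : A.P j ≡ B.P j'
        Q-eq   : A.Q j ≡ B.Q j'

    -- if the parents were crossed, Q j ⇝ P j = Q' j' ⇝ P' j' = Q j would be a cycle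
    coincide-at-V : ∀ {j j'} → j < k → j' < k' → A.V j ≡ B.V j' → Coincide j j'
    coincide-at-V {j} {j'} j<k j'<k' V≡V' with parent-of-V (B.P→V j') | parent-of-V (B.Q→V j')
      where
        parent-of-V : ∀ {x} → arc x (B.V j') ≡ true → x ≡ A.P j ⊎ x ≡ A.Q j
        parent-of-V x→V' = parent-one-of-two (A.P→V j) (A.Q→V j) (A.P≢Q j j)
                             (subst (λ v → arc _ v ≡ true) (sym V≡V') x→V')
    ... | inj₁ P'≡P | inj₂ Q'≡Q = coincide j<k j'<k' V≡V' (sym P'≡P) (sym Q'≡Q)
    ... | inj₁ P'≡P | inj₁ Q'≡P = ⊥-elim (B.P≢Q j' j' (trans P'≡P (sym Q'≡P)))
    ... | inj₂ P'≡Q | inj₂ Q'≡Q = ⊥-elim (B.P≢Q j' j' (trans P'≡Q (sym Q'≡Q)))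
    ... | inj₂ P'≡Q | inj₁ Q'≡P =
      ⊥-elim (acyclic (A.Q j) (A.Q⇝P j<k ++⁺ subst₂ (Path⁺ arc) Q'≡P P'≡Q (B.Q⇝P j'<k')))

    reticulate-children≡ : ∀ i i' {s s'} → s ≡ s' → HasNonReticulateChild s →
                           arc s (A.V i) ≡ true → arc s' (B.V i') ≡ true → A.V i ≡ B.V i'
    reticulate-children≡ i i' refl c s→V s→V' =
      reticulate-child-unique c s→V (A.V-reticulation i) s→V' (B.V-reticulation i')

    spine-children≡ : ∀ i {s s' y y'} → s ≡ s' → arc s (A.V i) ≡ true →
                      arc s y ≡ true → ¬ Reticulation y →
                      arc s' y' ≡ true → ¬ Reticulation y' → y ≡ y'
    spine-children≡ i refl s→V = nonreticulate-child-unique s→V (A.V-reticulation i)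

    coincide-at-P : ∀ {i i'} → i < k → i' < k' → A.P i ≡ B.P i' → Coincide i i'
    coincide-at-P {i} {i'} i<k i'<k' P≡P' = coincide-at-V i<k i'<k'
      (reticulate-children≡ i i' P≡P' (A.P-nonreticulate-child i<k) (A.P→V i) (B.P→V i'))

    coincide-at-Q : ∀ {i i'} → i < k → i' < k' → A.Q i ≡ B.Q i' → Coincide i i'
    coincide-at-Q {i} {i'} i<k i'<k' Q≡Q' = coincide-at-V i<k i'<k'
      (reticulate-children≡ i i' Q≡Q' (A.Q-nonreticulate-child i<k) (A.Q→V i) (B.Q→V i'))

    P≢Q' : ∀ {i i'} → i < k → i' < k' → A.P i ≢ B.Q i'
    P≢Q' {i} {i'} i<k i'<k' P≡Q' = B.P≢Q i' i' (trans (sym (Coincide.P-eq shared)) P≡Q')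
      where shared : Coincide i i'
            shared = coincide-at-V i<k i'<k'
              (reticulate-children≡ i i' P≡Q' (A.P-nonreticulate-child i<k) (A.P→V i) (B.Q→V i'))

    Q≢P' : ∀ {i i'} → i < k → i' < k' → A.Q i ≢ B.P i'
    Q≢P' {i} {i'} i<k i'<k' Q≡P' = B.P≢Q i' i' (trans (sym Q≡P') (Coincide.Q-eq shared))
      where shared : Coincide i i'
            shared = coincide-at-V i<k i'<k'
              (reticulate-children≡ i i' Q≡P' (A.Q-nonreticulate-child i<k) (A.Q→V i) (B.P→V i'))

    coincide-at-shared-vertex : ∀ {x x'} → RetOrSpine x → RetOrSpine x' →
                                TightLadder.φ C x ≡ TightLadder.φ C' x' →
                                Σ ℕ λ j → Σ ℕ λ j' → Coincide j j'
    coincide-at-shared-vertex (isRet i) (isRet i') e =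
      _ , _ , coincide-at-V (toℕ<n i) (toℕ<n i') (subst₂ _≡_ (A.ret≡V i) (B.ret≡V i') e)
    coincide-at-shared-vertex (isP i) (isP i') e =
      _ , _ , coincide-at-P (toℕ<n i) (toℕ<n i') (subst₂ _≡_ (A.pv≡P i) (B.pv≡P i') e)
    coincide-at-shared-vertex (isQ i) (isQ i') e =
      _ , _ , coincide-at-Q (toℕ<n i) (toℕ<n i') (subst₂ _≡_ (A.qv≡Q i) (B.qv≡Q i') e)
    coincide-at-shared-vertex (isP i) (isQ i') e =
      ⊥-elim (P≢Q' (toℕ<n i) (toℕ<n i') (subst₂ _≡_ (A.pv≡P i) (B.qv≡Q i') e))
    coincide-at-shared-vertex (isQ i) (isP i') e =
      ⊥-elim (Q≢P' (toℕ<n i) (toℕ<n i') (subst₂ _≡_ (A.qv≡Q i) (B.pv≡P i') e))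
    coincide-at-shared-vertex (isRet i) (isP i') e = ⊥-elim (reticulation≢
      (A.V-reticulation (toℕ i)) (B.P-¬reticulation (toℕ<n i'))
      (subst₂ _≡_ (A.ret≡V i) (B.pv≡P i') e))
    coincide-at-shared-vertex (isRet i) (isQ i') e = ⊥-elim (reticulation≢
      (A.V-reticulation (toℕ i)) (B.Q-¬reticulation (toℕ<n i'))
      (subst₂ _≡_ (A.ret≡V i) (B.qv≡Q i') e))
    coincide-at-shared-vertex (isP i) (isRet i') e = ⊥-elim (reticulation≢
      (B.V-reticulation (toℕ i')) (A.P-¬reticulation (toℕ<n i))
      (subst₂ _≡_ (B.ret≡V i') (A.pv≡P i) (sym e)))
    coincide-at-shared-vertex (isQ i) (isRet i') e = ⊥-elim (reticulation≢
      (B.V-reticulation (toℕ i')) (A.Q-¬reticulation (toℕ<n i))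
      (subst₂ _≡_ (B.ret≡V i') (A.qv≡Q i) (sym e)))

    descend : ∀ {m m'} → Coincide (2 + m) (2 + m') → Coincide m m'
    descend {m} {m'} (coincide 2+m<k 2+m'<k' _ P≡P' _) =
      coincide-at-Q m<k m'<k' (spine-children≡ (2 + m) P≡P' (A.P→V (2 + m))
        (A.P→Q 2+m<k) (A.Q-¬reticulation m<k) (B.P→Q 2+m'<k') (B.Q-¬reticulation m'<k'))
      where m<k : m < k
            m<k = A.pred< (A.pred< 2+m<k)
            m'<k' : m' < k'
            m'<k' = B.pred< (B.pred< 2+m'<k')

    ¬coincide-1-2+ : ∀ {m'} → ¬ Coincide 1 (2 + m')
    ¬coincide-1-2+ {m'} (coincide 1<k 2+m'<k' _ P≡P' _) =
      P≢Q' 0<k m'<k' (spine-children≡ 1 P≡P' (A.P→V 1)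
        (A.P₁→P₀ 1<k) (A.P-¬reticulation 0<k) (B.P→Q 2+m'<k') (B.Q-¬reticulation m'<k'))
      where 0<k : 0 < k
            0<k = A.pred< 1<k
            m'<k' : m' < k'
            m'<k' = B.pred< (B.pred< 2+m'<k')

    descend-1-1 : Coincide 1 1 → Coincide 0 0
    descend-1-1 (coincide 1<k 1<k' _ P≡P' _) =
      coincide-at-P 0<k 0<k' (spine-children≡ 1 P≡P' (A.P→V 1)
        (A.P₁→P₀ 1<k) (A.P-¬reticulation 0<k) (B.P₁→P₀ 1<k') (B.P-¬reticulation 0<k'))
      where 0<k : 0 < k
            0<k = A.pred< 1<k
            0<k' : 0 < k'
            0<k' = B.pred< 1<k'

    ¬coincide-0-suc : ∀ {j'} → ¬ Coincide 0 (suc j')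
    ¬coincide-0-suc {j'} (coincide 0<k 1+j'<k' _ P≡P' Q≡Q') =
      by-spine-arcs (A.qSpineArc 0<k) (B.qSpineArc 1+j'<k')
      where
        j'<k' : j' < k'
        j'<k' = B.pred< 1+j'<k'

        Q-children≡ : ∀ {y y'} → arc (A.Q 0) y ≡ true → ¬ Reticulation y →
                      arc (B.Q (suc j')) y' ≡ true → ¬ Reticulation y' → y ≡ y'
        Q-children≡ = spine-children≡ 0 Q≡Q' (A.Q→V 0)

        by-spine-arcs : A.QSpineArc 0 → B.QSpineArc (suc j') → ⊥
        by-spine-arcs (inner 1<k) (inner 2+j'<k') = ¬coincide-1-2+ (coincide-at-P 1<k 2+j'<k'
          (Q-children≡ (A.Q→P 1<k) (A.P-¬reticulation 1<k)
                       (B.Q→P 2+j'<k') (B.P-¬reticulation 2+j'<k')))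
        by-spine-arcs (inner 1<k) (top k'≡2+j') = P≢Q' 1<k j'<k'
          (Q-children≡ (A.Q→P 1<k) (A.P-¬reticulation 1<k)
                       (B.Q-top→Q k'≡2+j') (B.Q-¬reticulation j'<k'))
        by-spine-arcs (single k≡1) (inner 2+j'<k') = 1+n≢n (B.P-injective 2+j'<k' 1+j'<k'
          (trans (sym (Q-children≡ (A.Q₀→P₀ k≡1) (A.P-¬reticulation 0<k)
                                   (B.Q→P 2+j'<k') (B.P-¬reticulation 2+j'<k')))
                 P≡P'))
        by-spine-arcs (single k≡1) (top k'≡2+j') = P≢Q' 0<k j'<k'
          (Q-children≡ (A.Q₀→P₀ k≡1) (A.P-¬reticulation 0<k)
                       (B.Q-top→Q k'≡2+j') (B.Q-¬reticulation j'<k'))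

    ascend : ∀ {i} → Coincide i i → suc i < k → Coincide (suc i) (suc i)
    ascend {i} (coincide i<k i<k' _ P≡P' Q≡Q') 1+i<k = by-spine-arc (B.qSpineArc i<k')
      where
        Q-children≡ : ∀ {y y'} → arc (A.Q i) y ≡ true → ¬ Reticulation y →
                      arc (B.Q i) y' ≡ true → ¬ Reticulation y' → y ≡ y'
        Q-children≡ = spine-children≡ i Q≡Q' (A.Q→V i)

        P[1+i]≡ : ∀ {y'} → arc (B.Q i) y' ≡ true → ¬ Reticulation y' → A.P (suc i) ≡ y'
        P[1+i]≡ = Q-children≡ (A.Q→P 1+i<k) (A.P-¬reticulation 1+i<k)

        by-spine-arc : B.QSpineArc i → Coincide (suc i) (suc i)
        by-spine-arc (inner 1+i<k') =
          coincide-at-P 1+i<k 1+i<k' (P[1+i]≡ (B.Q→P 1+i<k') (B.P-¬reticulation 1+i<k'))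
        by-spine-arc (single k'≡1) = ⊥-elim (1+n≢n (A.P-injective 1+i<k i<k
          (trans (P[1+i]≡ (B.Q₀→P₀ k'≡1) (B.P-¬reticulation i<k')) (sym P≡P'))))
        by-spine-arc (top k'≡2+m) = ⊥-elim (P≢Q' 1+i<k (B.pred< i<k')
          (P[1+i]≡ (B.Q-top→Q k'≡2+m) (B.Q-¬reticulation (B.pred< i<k'))))

  open Pair public using (Coincide; coincide)

  coincide-sym : ∀ {C C' j j'} → Coincide C C' j j' → Coincide C' C j' j
  coincide-sym (coincide j<k j'<k' V≡V' P≡P' Q≡Q') =
    coincide j'<k' j<k (sym V≡V') (sym P≡P') (sym Q≡Q')

  coincide-at-base : ∀ C C' {j j'} → Coincide C C' j j' → Coincide C C' 0 0
  coincide-at-base C C' {zero}        {zero}         c = c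
  coincide-at-base C C' {zero}        {suc _}        c = ⊥-elim (Pair.¬coincide-0-suc C C' c)
  coincide-at-base C C' {suc _}       {zero}         c = ⊥-elim (Pair.¬coincide-0-suc C' C (coincide-sym c))
  coincide-at-base C C' {suc zero}    {suc zero}     c = Pair.descend-1-1 C C' c
  coincide-at-base C C' {suc zero}    {suc (suc _)}  c = ⊥-elim (Pair.¬coincide-1-2+ C C' c)
  coincide-at-base C C' {suc (suc _)} {suc zero}     c = ⊥-elim (Pair.¬coincide-1-2+ C' C (coincide-sym c))
  coincide-at-base C C' {suc (suc _)} {suc (suc _)}  c = coincide-at-base C C' (Pair.descend C C' c)

  coincide-everywhere : ∀ {C C'} → Coincide C C' 0 0 → ∀ i → i < TightLadder.k C → Coincide C C' i i
  coincide-everywhere         c zero    _     = c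
  coincide-everywhere {C} {C'} c (suc i) 1+i<k =
    Pair.ascend C C' (coincide-everywhere c i (Ladder.pred< C 1+i<k)) 1+i<k

  images-agree : ∀ {C C'} → Coincide C C' 0 0 →
                 ∀ (i : Fin (TightLadder.k C)) (i' : Fin (TightLadder.k C')) → toℕ i ≡ toℕ i' →
                 (TightLadder.φ C (ret i) ≡ TightLadder.φ C' (ret i'))
                 × (TightLadder.φ C (pv i) ≡ TightLadder.φ C' (pv i'))
                 × (TightLadder.φ C (qv i) ≡ TightLadder.φ C' (qv i'))
  images-agree {C} {C'} base i i' i≡i'
    with subst (Coincide C C' (toℕ i)) i≡i' (coincide-everywhere base (toℕ i) (toℕ<n i))
  ... | coincide _ _ V≡V' P≡P' Q≡Q' =
      subst₂ _≡_ (sym (A.ret≡V i)) (sym (B.ret≡V i')) V≡V'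
    , subst₂ _≡_ (sym (A.pv≡P i)) (sym (B.pv≡P i')) P≡P'
    , subst₂ _≡_ (sym (A.qv≡Q i)) (sym (B.qv≡Q i')) Q≡Q'
    where module A = Ladder C; module B = Ladder C'

open NetworkProperties

lemma11 : ∀ {n : ℕ} (N : Network n) → TreeChild N →
          (C C' : TightLadder N) (u : Fin n) →
          Σ (LV (TightLadder.k C)) (λ x → RetOrSpine x × TightLadder.φ C x ≡ u) →
          Σ (LV (TightLadder.k C')) (λ x' → RetOrSpine x' × TightLadder.φ C' x' ≡ u) →
          (TightLadder.k C ≡ TightLadder.k C')
          × (∀ (i : Fin (TightLadder.k C)) (i' : Fin (TightLadder.k C')) → toℕ i ≡ toℕ i' →
               (TightLadder.φ C (ret i) ≡ TightLadder.φ C' (ret i'))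
               × (TightLadder.φ C (pv i) ≡ TightLadder.φ C' (pv i'))
               × (TightLadder.φ C (qv i) ≡ TightLadder.φ C' (qv i')))
lemma11 N _ C C' u (x , x-on-C , φx≡u) (x' , x'-on-C' , φ'x'≡u) = k≡k' , images-agree N base
  where
    base : Coincide N C C' 0 0
    base with Pair.coincide-at-shared-vertex N C C' x-on-C x'-on-C' (trans φx≡u (sym φ'x'≡u))
    ... | _ , _ , shared = coincide-at-base N C C' shared

    k≡k' : TightLadder.k C ≡ TightLadder.k C'
    k≡k' = ≤-antisym
      (Coincide.bound' (coincide-everywhere N base (TightLadder.k₀ C) ≤-refl))
      (Coincide.bound' (coincide-everywhere N (coincide-sym N base) (TightLadder.k₀ C') ≤-refl))
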